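{- Let $V=\{1,\dots,n\}$, let $f:2^V\to\mathbb{R}$ be submodular and $g:2^V\to\mathbb{R}$ be supermodular with $f(X)\le g(X)$ for all $X\subseteq V$, and let $A\in\operatorname{argmin}_{X\subseteq V}[g(X)-f(X)]$. Then there exists a modular function $h$ such that $f(X)\le h(X)\le g(X)$ for all $X\subseteq V$ with $X\subseteq A$ or $X\supseteq A$.
   Context: $f$ is submodular if $f(S)+f(T)\ge f(S\cup T)+f(S\cap T)$ for all $S,T\subseteq V$; $g$ is supermodular if $-g$ is submodular. A modular function is one of the form $h(X)=c+\sum_{j\in X}w_j$ with $c\in\mathbb{R}$, $w\in\mathbb{R}^n$. -}

module Defs where

open import Level using (Level; _⊔_) renaming (suc to lsuc)
open import Data.Fin using (Fin; zero; suc)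
open import Data.Bool using (true; false)
open import Data.Vec using ([]; _∷_)
open import Data.Fin.Subset using (Subset; _∪_; _∩_)
open import Data.Product using (∃; Σ; _×_)
open import Relation.Nullary using (¬_)
open import Relation.Binary using (Rel; IsTotalOrder)
open import Algebra.Bundles using (CommutativeRing)

-- An ordered field (real-valued set functions are modelled by functions into
-- an arbitrary ordered field; ℝ is one instance).
record OrderedField (c ℓ₁ ℓ₂ : Level) : Set (lsuc (c ⊔ ℓ₁ ⊔ ℓ₂)) where
  field
    commutativeRing : CommutativeRing c ℓ₁
  open CommutativeRing commutativeRing public
  infix 4 _≤_
  field
    _≤_          : Rel Carrier ℓ₂
    isTotalOrder : IsTotalOrder _≈_ _≤_
    +-mono-≤     : ∀ {x y} z → x ≤ y → x + z ≤ y + z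
    *-nonneg     : ∀ {x y} → 0# ≤ x → 0# ≤ y → 0# ≤ x * y
    0≉1          : ¬ (0# ≈ 1#)
    inverse      : ∀ x → ¬ (x ≈ 0#) → ∃ λ y → x * y ≈ 1#

module SetFunctions {c ℓ₁ ℓ₂} (F : OrderedField c ℓ₁ ℓ₂) where
  open OrderedField F public hiding (zero)

  sumOver : ∀ {n} → (Fin n → Carrier) → Subset n → Carrier
  sumOver w []          = 0#
  sumOver w (true ∷ X)  = w zero + sumOver (λ j → w (suc j)) X
  sumOver w (false ∷ X) = sumOver (λ j → w (suc j)) X

  Submodular : ∀ {n} → (Subset n → Carrier) → Set ℓ₂
  Submodular f = ∀ S T → f (S ∪ T) + f (S ∩ T) ≤ f S + f T

  Supermodular : ∀ {n} → (Subset n → Carrier) → Set ℓ₂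
  Supermodular g = Submodular (λ X → - g X)

  Modular : ∀ {n} → (Subset n → Carrier) → Set (c ⊔ ℓ₁)
  Modular {n} h = Σ Carrier λ c₀ → Σ (Fin n → Carrier) λ w →
    ∀ X → h X ≈ c₀ + sumOver w X

  IsArgmin : ∀ {n} → (Subset n → Carrier) → Subset n → Set ℓ₂
  IsArgmin φ A = ∀ X → φ A ≤ φ X

module Submission where

-- h is the tangent of f at A: with marginals w_k = f(A ∪ {k}) − f(A ∖ {k}),
-- h(X) = f(A) − Σ_{k∈A} w_k + Σ_{k∈X} w_k.
--  * Tangent lemma: a submodular φ lies below its tangent at A on sets
--    comparable with A (diminishing returns, one coordinate at a time);
--    via −g, a supermodular g lies above its tangent.  Hence f ≤ h.
--  * Comparison lemma: as A minimises g − f, f's marginals at A are at most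
--    g's outside A and at least g's inside A; so h − f(A) ≤ g's tangent − g(A)
--    ≤ g − g(A) on comparable sets, and f(A) ≤ g(A) gives h ≤ g.

open import Defs
open import Data.Nat using (ℕ)
open import Data.Fin.Subset using (Subset; _⊆_)
open import Data.Product using (Σ; _×_)
open import Data.Sum using (_⊎_)

import Data.Nat as ℕ
open import Data.Bool using (Bool; true; false)
open import Data.Empty using (⊥-elim)
open import Data.Fin using (Fin; zero; suc)
open import Data.Fin.Subset using (_∪_; _∩_)
open import Data.Fin.Subset.Properties
  using (⊆-antisym; drop-∷-⊆; q⊆p∪q; x∈p∪q⁻; p∩q⊆p; x∈p∩q⁺)
open import Data.Product using (_,_)
open import Data.Sum using (inj₁; inj₂; [_,_])
import Data.Sum as Sum
open import Data.Vec.Base using ([]; _∷_; here)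
open import Function using (id)
open import Relation.Binary using (IsTotalOrder)
open import Relation.Binary.Bundles using (Poset)
open import Relation.Binary.PropositionalEquality using (_≡_; subst₂)
open import Relation.Nullary using (¬_)
import Relation.Binary.Reasoning.PartialOrder as PosetReasoning
import Algebra.Properties.Group as GroupProperties
import Algebra.Properties.AbelianGroup as AbelianGroupProperties
import Algebra.Properties.CommutativeSemigroup as CommutativeSemigroupProperties

⊆⇒∪≡ : ∀ {n} {p q : Subset n} → p ⊆ q → p ∪ q ≡ q
⊆⇒∪≡ {p = p} {q} p⊆q = ⊆-antisym (λ x∈p∪q → [ p⊆q , id ] (x∈p∪q⁻ p q x∈p∪q)) (q⊆p∪q p q)

⊆⇒∩≡ : ∀ {n} {p q : Subset n} → p ⊆ q → p ∩ q ≡ p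
⊆⇒∩≡ {p = p} {q} p⊆q = ⊆-antisym (p∩q⊆p p q) (λ x∈p → x∈p∩q⁺ (x∈p , p⊆q x∈p))

Comparable : ∀ {n} → Subset n → Subset n → Set
Comparable X A = X ⊆ A ⊎ A ⊆ X

comparable-tail : ∀ {n} {x a : Bool} {X A : Subset n} → Comparable (x ∷ X) (a ∷ A) → Comparable X A
comparable-tail = Sum.map drop-∷-⊆ drop-∷-⊆

in⊈out : ∀ {n} {X A : Subset n} → ¬ (true ∷ X ⊆ false ∷ A)
in⊈out X⊆A with X⊆A here
... | ()

module Sandwich {c ℓ₁ ℓ₂} (F : OrderedField c ℓ₁ ℓ₂) where
  open SetFunctions F
  open GroupProperties +-group using (//-rightDividesˡ; //-rightDividesʳ; \\-leftDividesʳ; ε⁻¹≈ε)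
  open AbelianGroupProperties +-abelianGroup using (⁻¹-∙-comm)
  open CommutativeSemigroupProperties +-commutativeSemigroup using (interchange; x∙yz≈y∙xz; xy∙z≈xz∙y)

  poset : Poset c ℓ₁ ℓ₂
  poset = record { isPartialOrder = IsTotalOrder.isPartialOrder isTotalOrder }

  open Poset poset using (≤-respˡ-≈; ≤-respʳ-≈) renaming (refl to ≤-refl; trans to ≤-trans)
  open PosetReasoning poset

  +-monoʳ-≤ : ∀ z {x y} → x ≤ y → z + x ≤ z + y
  +-monoʳ-≤ z {x} {y} x≤y = begin
    z + x ≈⟨ +-comm z x ⟩
    x + z ≤⟨ +-mono-≤ z x≤y ⟩
    y + z ≈⟨ +-comm y z ⟩
    z + y ∎

  +-mono₂-≤ : ∀ {x y u v} → x ≤ y → u ≤ v → x + u ≤ y + v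
  +-mono₂-≤ {x} {y} {u} {v} x≤y u≤v = ≤-trans (+-mono-≤ u x≤y) (+-monoʳ-≤ y u≤v)

  +-cancelʳ-≤ : ∀ z {x y} → x + z ≤ y + z → x ≤ y
  +-cancelʳ-≤ z {x} {y} x+z≤y+z = begin
    x           ≈⟨ //-rightDividesʳ z x ⟨
    x + z - z   ≤⟨ +-mono-≤ (- z) x+z≤y+z ⟩
    y + z - z   ≈⟨ //-rightDividesʳ z y ⟩
    y           ∎

  ≤-swap : ∀ {x y u v} → x + y ≤ u + v → y + x ≤ v + u
  ≤-swap {x} {y} {u} {v} h = begin
    y + x ≈⟨ +-comm y x ⟩
    x + y ≤⟨ h ⟩
    u + v ≈⟨ +-comm u v ⟩
    v + u ∎

  +-shift : ∀ w {x y u v} → x + u ≤ y + v → x + (w + u) ≤ y + (w + v)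
  +-shift w {x} {y} {u} {v} h = begin
    x + (w + u) ≈⟨ x∙yz≈y∙xz x w u ⟩
    w + (x + u) ≤⟨ +-monoʳ-≤ w h ⟩
    w + (y + v) ≈⟨ x∙yz≈y∙xz w y v ⟩
    y + (w + v) ∎

  +-shift₂ : ∀ w w′ {x y u v} → x + u ≤ y + v → (w + x) + (w′ + u) ≤ (w + y) + (w′ + v)
  +-shift₂ w w′ {x} {y} {u} {v} h = begin
    (w + x) + (w′ + u) ≈⟨ interchange w x w′ u ⟩
    (w + w′) + (x + u) ≤⟨ +-monoʳ-≤ (w + w′) h ⟩
    (w + w′) + (y + v) ≈⟨ interchange w w′ y v ⟩
    (w + y) + (w′ + v) ∎

  -- x + p ≤ y + q says x − y ≤ q − p; such differences compose.
  +-≤-trans : ∀ {x y p q u v} → x + p ≤ y + q → q + u ≤ p + v → x + u ≤ y + v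
  +-≤-trans {x} {y} {p} {q} {u} {v} h₁ h₂ = +-cancelʳ-≤ (p + q) (begin
    (x + u) + (p + q) ≈⟨ interchange x u p q ⟩
    (x + p) + (u + q) ≈⟨ +-congˡ (+-comm u q) ⟩
    (x + p) + (q + u) ≤⟨ +-mono₂-≤ h₁ h₂ ⟩
    (y + q) + (p + v) ≈⟨ +-congˡ (+-comm p v) ⟩
    (y + q) + (v + p) ≈⟨ interchange y q v p ⟩
    (y + v) + (q + p) ≈⟨ +-congˡ (+-comm q p) ⟩
    (y + v) + (p + q) ∎)

  x+[y-x]≈y : ∀ x y → x + (y - x) ≈ y
  x+[y-x]≈y x y = trans (+-comm x (y - x)) (//-rightDividesˡ x y)

  [x-y+z]+y≈x+z : ∀ x y z → (x - y + z) + y ≈ x + z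
  [x-y+z]+y≈x+z x y z = trans (xy∙z≈xz∙y (x - y) z y) (+-congʳ (//-rightDividesˡ y x))

  ≤-moveˡ : ∀ {x y s t} → x + s ≤ y + t → x ≤ y - s + t
  ≤-moveˡ {x} {y} {s} {t} h = +-cancelʳ-≤ s (begin
    x + s           ≤⟨ h ⟩
    y + t           ≈⟨ [x-y+z]+y≈x+z y s t ⟨
    (y - s + t) + s ∎)

  ≤-moveʳ : ∀ {x y s t} → x + s ≤ y + t → x - t + s ≤ y
  ≤-moveʳ {x} {y} {s} {t} h = +-cancelʳ-≤ t (begin
    (x - t + s) + t ≈⟨ [x-y+z]+y≈x+z x t s ⟩
    x + s           ≤⟨ h ⟩
    y + t           ∎)

  -≤-⇒+≤+ : ∀ {a b c d} → a - b ≤ c - d → a + d ≤ c + b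
  -≤-⇒+≤+ {a} {b} {c} {d} h = begin
    a + d           ≈⟨ [x-y+z]+y≈x+z a b d ⟨
    (a - b + d) + b ≤⟨ +-mono-≤ b (+-mono-≤ d h) ⟩
    (c - d + d) + b ≈⟨ +-congʳ (//-rightDividesˡ d c) ⟩
    c + b           ∎

  +≤+⇒-≤- : ∀ {a b c d} → a + d ≤ c + b → a - b ≤ c - d
  +≤+⇒-≤- {a} {b} {c} {d} h = +-cancelʳ-≤ d (begin
    a - b + d ≤⟨ ≤-moveʳ h ⟩
    c         ≈⟨ //-rightDividesˡ d c ⟨
    c - d + d ∎)

  -‿cancel-≤ : ∀ {x y} → - x ≤ - y → y ≤ x
  -‿cancel-≤ {x} {y} h = begin
    y             ≈⟨ \\-leftDividesʳ x y ⟨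
    - x + (x + y) ≤⟨ +-mono-≤ (x + y) h ⟩
    - y + (x + y) ≈⟨ +-congˡ (+-comm x y) ⟩
    - y + (y + x) ≈⟨ \\-leftDividesʳ y x ⟩
    x             ∎

  neg-flip : ∀ {a b c d} → - a + - b ≤ - c + - d → c + d ≤ a + b
  neg-flip {a} {b} {c} {d} h = -‿cancel-≤ (begin
    - (a + b) ≈⟨ ⁻¹-∙-comm a b ⟨
    - a + - b ≤⟨ h ⟩
    - c + - d ≈⟨ ⁻¹-∙-comm c d ⟩
    - (c + d) ∎)

  restrict : ∀ {n} → (Subset (ℕ.suc n) → Carrier) → Bool → Subset n → Carrier
  restrict φ a Y = φ (a ∷ Y)

  restrict-submodular : ∀ {n} (φ : Subset (ℕ.suc n) → Carrier) a →
                        Submodular φ → Submodular (restrict φ a)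
  restrict-submodular φ true  sub S T = sub (true ∷ S) (true ∷ T)
  restrict-submodular φ false sub S T = sub (false ∷ S) (false ∷ T)

  diminishingReturns : ∀ {n} (φ : Subset (ℕ.suc n) → Carrier) → Submodular φ →
                       ∀ {A X} → A ⊆ X →
                       φ (true ∷ X) + φ (false ∷ A) ≤ φ (true ∷ A) + φ (false ∷ X)
  diminishingReturns φ sub {A} {X} A⊆X =
    subst₂ (λ U I → φ (true ∷ U) + φ (false ∷ I) ≤ φ (true ∷ A) + φ (false ∷ X))
           (⊆⇒∪≡ A⊆X) (⊆⇒∩≡ A⊆X) (sub (true ∷ A) (false ∷ X))

  marginal : ∀ {n} → (Subset n → Carrier) → Subset n → Fin n → Carrier
  marginal φ (_ ∷ A) zero    = φ (true ∷ A) - φ (false ∷ A)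
  marginal φ (a ∷ A) (suc k) = marginal (restrict φ a) A k

  marginalSum : ∀ {n} → (Subset n → Carrier) → Subset n → Subset n → Carrier
  marginalSum φ A = sumOver (marginal φ A)

  tangent-step : ∀ {n} (φ : Subset (ℕ.suc n) → Carrier) → Submodular φ →
                 ∀ a x A X → Comparable (x ∷ X) (a ∷ A) →
                 restrict φ a X + marginalSum (restrict φ a) A A
                   ≤ restrict φ a A + marginalSum (restrict φ a) A X →
                 φ (x ∷ X) + marginalSum φ (a ∷ A) (a ∷ A)
                   ≤ φ (a ∷ A) + marginalSum φ (a ∷ A) (x ∷ X)
  tangent-step φ sub true  true  A X _  ih = +-shift (marginal φ (true ∷ A) zero) ih
  tangent-step φ sub false false A X _  ih = ih
  tangent-step φ sub false true  A X (inj₁ X⊆A) ih = ⊥-elim (in⊈out X⊆A)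
  tangent-step φ sub false true  A X (inj₂ A⊆X) ih = begin
    φ (true ∷ X) + S A          ≤⟨ +-≤-trans (diminishingReturns φ sub (drop-∷-⊆ A⊆X)) ih ⟩
    φ (true ∷ A) + S X          ≈⟨ +-congʳ (x+[y-x]≈y (φ (false ∷ A)) (φ (true ∷ A))) ⟨
    (φ (false ∷ A) + w) + S X   ≈⟨ +-assoc (φ (false ∷ A)) w (S X) ⟩
    φ (false ∷ A) + (w + S X)   ∎
    where
    S : Subset _ → Carrier
    S = marginalSum (restrict φ false) A
    w : Carrier
    w = marginal φ (false ∷ A) zero
  tangent-step φ sub true  false A X (inj₂ A⊆X) ih = ⊥-elim (in⊈out A⊆X)
  tangent-step φ sub true  false A X (inj₁ X⊆A) ih = begin
    φ (false ∷ X) + (w + S A)   ≤⟨ +-shift w (+-≤-trans dr ih) ⟩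
    φ (false ∷ A) + (w + S X)   ≈⟨ +-assoc (φ (false ∷ A)) w (S X) ⟨
    (φ (false ∷ A) + w) + S X   ≈⟨ +-congʳ (x+[y-x]≈y (φ (false ∷ A)) (φ (true ∷ A))) ⟩
    φ (true ∷ A) + S X          ∎
    where
    S : Subset _ → Carrier
    S = marginalSum (restrict φ true) A
    w : Carrier
    w = marginal φ (true ∷ A) zero
    dr : φ (false ∷ X) + φ (true ∷ A) ≤ φ (false ∷ A) + φ (true ∷ X)
    dr = ≤-swap (diminishingReturns φ sub (drop-∷-⊆ X⊆A))

  tangent : ∀ {n} (φ : Subset n → Carrier) → Submodular φ → ∀ A X → Comparable X A →
            φ X + marginalSum φ A A ≤ φ A + marginalSum φ A X
  tangent φ sub []      []      _   = ≤-refl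
  tangent φ sub (a ∷ A) (x ∷ X) cmp = tangent-step φ sub a x A X cmp
    (tangent (restrict φ a) (restrict-submodular φ a sub) A X (comparable-tail cmp))

  marginalSum-neg : ∀ {n} (φ : Subset n → Carrier) A X →
                    marginalSum (λ Y → - φ Y) A X ≈ - marginalSum φ A X
  marginalSum-neg φ []      []          = sym ε⁻¹≈ε
  marginalSum-neg φ (a ∷ A) (true ∷ X)  = trans
    (+-cong (⁻¹-∙-comm (φ (true ∷ A)) (- φ (false ∷ A))) (marginalSum-neg (restrict φ a) A X))
    (⁻¹-∙-comm (marginal φ (a ∷ A) zero) (marginalSum (restrict φ a) A X))
  marginalSum-neg φ (a ∷ A) (false ∷ X) = marginalSum-neg (restrict φ a) A X

  supermodular-tangent : ∀ {n} (g : Subset n → Carrier) → Supermodular g →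
                         ∀ A X → Comparable X A →
                         g A + marginalSum g A X ≤ g X + marginalSum g A A
  supermodular-tangent g sup A X cmp = neg-flip (begin
    - g X + - marginalSum g A A           ≈⟨ +-congˡ (marginalSum-neg g A A) ⟨
    - g X + marginalSum (λ Y → - g Y) A A ≤⟨ tangent (λ Y → - g Y) sup A X cmp ⟩
    - g A + marginalSum (λ Y → - g Y) A X ≈⟨ +-congˡ (marginalSum-neg g A X) ⟩
    - g A + - marginalSum g A X           ∎)

  comparison-step : ∀ {n} (f g : Subset (ℕ.suc n) → Carrier) a x A X →
                    IsArgmin (λ Y → g Y - f Y) (a ∷ A) →
                    marginalSum (restrict g a) A A + marginalSum (restrict f a) A X
                      ≤ marginalSum (restrict g a) A X + marginalSum (restrict f a) A A →
                    marginalSum g (a ∷ A) (a ∷ A) + marginalSum f (a ∷ A) (x ∷ X)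
                      ≤ marginalSum g (a ∷ A) (x ∷ X) + marginalSum f (a ∷ A) (a ∷ A)
  comparison-step f g true  true  A X argmin ih =
    +-shift₂ (marginal g (true ∷ A) zero) (marginal f (true ∷ A) zero) ih
  comparison-step f g false false A X argmin ih = ih
  comparison-step f g false true  A X argmin ih = begin
    Sg A + (wf + Sf X) ≈⟨ x∙yz≈y∙xz (Sg A) wf (Sf X) ⟩
    wf + (Sg A + Sf X) ≤⟨ +-mono₂-≤ wf≤wg ih ⟩
    wg + (Sg X + Sf A) ≈⟨ +-assoc wg (Sg X) (Sf A) ⟨
    (wg + Sg X) + Sf A ∎
    where
    Sf Sg : Subset _ → Carrier
    Sf = marginalSum (restrict f false) A
    Sg = marginalSum (restrict g false) A
    wf wg : Carrier
    wf = marginal f (false ∷ A) zero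
    wg = marginal g (false ∷ A) zero
    -- Adding the first element to A raises g − f.
    wf≤wg : wf ≤ wg
    wf≤wg = +≤+⇒-≤- (≤-respˡ-≈ (+-comm (g (false ∷ A)) (f (true ∷ A)))
                              (-≤-⇒+≤+ (argmin (true ∷ A))))
  comparison-step f g true  false A X argmin ih = begin
    (wg + Sg A) + Sf X ≈⟨ +-assoc wg (Sg A) (Sf X) ⟩
    wg + (Sg A + Sf X) ≤⟨ +-mono₂-≤ wg≤wf ih ⟩
    wf + (Sg X + Sf A) ≈⟨ x∙yz≈y∙xz wf (Sg X) (Sf A) ⟩
    Sg X + (wf + Sf A) ∎
    where
    Sf Sg : Subset _ → Carrier
    Sf = marginalSum (restrict f true) A
    Sg = marginalSum (restrict g true) A
    wf wg : Carrier
    wf = marginal f (true ∷ A) zero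
    wg = marginal g (true ∷ A) zero
    -- Removing the first element from A raises g − f.
    wg≤wf : wg ≤ wf
    wg≤wf = +≤+⇒-≤- (≤-respʳ-≈ (+-comm (g (false ∷ A)) (f (true ∷ A)))
                              (-≤-⇒+≤+ (argmin (false ∷ A))))

  comparison : ∀ {n} (f g : Subset n → Carrier) A → IsArgmin (λ Y → g Y - f Y) A → ∀ X →
               marginalSum g A A + marginalSum f A X ≤ marginalSum g A X + marginalSum f A A
  comparison f g []      argmin []      = ≤-refl
  comparison f g (a ∷ A) argmin (x ∷ X) = comparison-step f g a x A X argmin
    (comparison (restrict f a) (restrict g a) A (λ Y → argmin (a ∷ Y)) X)

  tangentAt : ∀ {n} → (Subset n → Carrier) → Subset n → Subset n → Carrier
  tangentAt f A X = f A - marginalSum f A A + marginalSum f A X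

  tangentAt-modular : ∀ {n} (f : Subset n → Carrier) A → Modular (tangentAt f A)
  tangentAt-modular f A = f A - marginalSum f A A , marginal f A , λ X → refl

  f≤tangentAt : ∀ {n} (f : Subset n → Carrier) → Submodular f →
                ∀ A X → Comparable X A → f X ≤ tangentAt f A X
  f≤tangentAt f sub A X cmp = ≤-moveˡ (tangent f sub A X cmp)

  -- Upper bound: tangent of f ≤ tangent of g (comparison) ≤ g, using f(A) ≤ g(A).
  tangentAt≤g : ∀ {n} (f g : Subset n → Carrier) → Supermodular g → (∀ X → f X ≤ g X) →
                ∀ A → IsArgmin (λ Y → g Y - f Y) A → ∀ X → Comparable X A →
                tangentAt f A X ≤ g X
  tangentAt≤g f g sup f≤g A argmin X cmp = ≤-moveʳ (begin
    f A + marginalSum f A X ≤⟨ +-mono-≤ (marginalSum f A X) (f≤g A) ⟩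
    g A + marginalSum f A X ≤⟨ +-≤-trans (supermodular-tangent g sup A X cmp)
                                           (comparison f g A argmin X) ⟩
    g X + marginalSum f A A ∎)

mainTheorem19 : ∀ {c ℓ₁ ℓ₂} (F : OrderedField c ℓ₁ ℓ₂) → let open SetFunctions F in
    (n : ℕ) (f g : Subset n → Carrier) →
    Submodular f → Supermodular g → (∀ X → f X ≤ g X) →
    (A : Subset n) → IsArgmin (λ X → g X - f X) A →
    Σ (Subset n → Carrier) λ h → Modular h ×
      (∀ X → (X ⊆ A ⊎ A ⊆ X) → (f X ≤ h X × h X ≤ g X))
mainTheorem19 F n f g sub sup f≤g A argmin =
  tangentAt f A , tangentAt-modular f A ,
  λ X cmp → f≤tangentAt f sub A X cmp , tangentAt≤g f g sup f≤g A argmin X cmp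
  where open Sandwich F
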